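{- For any $\mathcal L_{\mathsf{pf}}$-formula $A$, $\mathbf{PF}\vdash(\Box_{\mathsf p}A\to\Box_{\mathsf f}A)\leftrightarrow\Box_{\mathsf f}(\Box_{\mathsf p}A\to A)$.
   Context: $\mathcal L_{\mathsf{pf}}$ is the bimodal propositional language with modal operators $\Box_{\mathsf p},\Box_{\mathsf f}$ ($\Diamond=\neg\Box\neg$). $\mathbf{PF}$ is the logic with axioms: propositional tautologies; $\Box_{\mathsf p}(A\to B)\to(\Box_{\mathsf p}A\to\Box_{\mathsf p}B)$; $\Box_{\mathsf p}(\Box_{\mathsf p}A\to A)\to\Box_{\mathsf p}A$; $\Box_{\mathsf f}(A\to B)\to(\Box_{\mathsf f}A\to\Box_{\mathsf f}B)$; $\Box_{\mathsf f}A\to A$; $\Box_{\mathsf f}A\to\Box_{\mathsf f}\Box_{\mathsf f}A$; $\Diamond_{\mathsf f}\Box_{\mathsf f}A\to\Box_{\mathsf f}\Diamond_{\mathsf f}A$; $\Box_{\mathsf p}A\to\Box_{\mathsf f}\Box_{\mathsf p}A$; $\Diamond_{\mathsf p}A\to\Box_{\mathsf f}\Diamond_{\mathsf p}A$; $\Box_{\mathsf p}A\to\Box_{\mathsf p}\Box_{\mathsf f}A$; rules modus ponens and necessitation for $\Box_{\mathsf p}$ and $\Box_{\mathsf f}$. -}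

module Defs where

open import Data.Nat using (ℕ)
open import Data.Bool using (Bool; true; false; not; _∧_; _∨_)
open import Relation.Binary.PropositionalEquality using (_≡_)

infixr 5 _⇒_
data Fm : Set where
  var : ℕ → Fm
  ⊥'  : Fm
  _⇒_ : Fm → Fm → Fm
  □p  : Fm → Fm
  □f  : Fm → Fm

¬' : Fm → Fm
¬' A = A ⇒ ⊥'

⊤' : Fm
⊤' = ¬' ⊥'

_∧'_ : Fm → Fm → Fm
A ∧' B = ¬' (A ⇒ ¬' B)

infix 4 _⇔_
infixr 6 _∧'_
_⇔_ : Fm → Fm → Fm
A ⇔ B = (A ⇒ B) ∧' (B ⇒ A)

◇p : Fm → Fm
◇p A = ¬' (□p (¬' A))

◇f : Fm → Fm
◇f A = ¬' (□f (¬' A))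

-- Propositional (truth-functional) evaluation: variables and boxed formulas
-- are treated as propositional atoms, whose truth values are given by v.
data Atom : Set where
  avar : ℕ → Atom
  abp  : Fm → Atom
  abf  : Fm → Atom

eval : (Atom → Bool) → Fm → Bool
eval v (var n) = v (avar n)
eval v ⊥'      = false
eval v (A ⇒ B) = not (eval v A) ∨ eval v B
eval v (□p A)  = v (abp A)
eval v (□f A)  = v (abf A)

-- A is a (substitution instance of a) propositional tautology.
Tautology : Fm → Set
Tautology A = ∀ (v : Atom → Bool) → eval v A ≡ true

infix 3 PF⊢_
data PF⊢_ : Fm → Set where
  taut   : ∀ {A} → Tautology A → PF⊢ A
  Kp     : ∀ A B → PF⊢ □p (A ⇒ B) ⇒ (□p A ⇒ □p B)
  Lp     : ∀ A → PF⊢ □p (□p A ⇒ A) ⇒ □p A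
  Kf     : ∀ A B → PF⊢ □f (A ⇒ B) ⇒ (□f A ⇒ □f B)
  Tf     : ∀ A → PF⊢ □f A ⇒ A
  4f     : ∀ A → PF⊢ □f A ⇒ □f (□f A)
  Gf     : ∀ A → PF⊢ ◇f (□f A) ⇒ □f (◇f A)
  pf□    : ∀ A → PF⊢ □p A ⇒ □f (□p A)
  pf◇    : ∀ A → PF⊢ ◇p A ⇒ □f (◇p A)
  pp□f   : ∀ A → PF⊢ □p A ⇒ □p (□f A)
  mp     : ∀ {A B} → PF⊢ A ⇒ B → PF⊢ A → PF⊢ B
  necp   : ∀ {A} → PF⊢ A → PF⊢ □p A
  necf   : ∀ {A} → PF⊢ A → PF⊢ □f A

-- A formula B is □f-settled when both B ⇒ □f B and ¬B ⇒ □f ¬B are provable.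
-- For settled B, B ⇒ □f C and □f (B ⇒ C) are equivalent: if B holds, □f C
-- gives □f (B ⇒ C); if not, □f ¬B does; conversely □f B and K yield □f C.
-- □p A is settled: □p A ⇒ □f □p A is an axiom, and ¬□p A ⇒ □f ¬□p A is the axiom
-- ◇p ¬A ⇒ □f ◇p ¬A read through the duality ¬□p A ↔ ◇p ¬A.
module Submission where

open import Defs
open import Data.Nat using (ℕ; zero; suc)
open import Data.Fin using (Fin; zero; suc)
open import Data.Bool using (Bool; true; false; not; _∧_; _∨_; T)
open import Data.Bool.Properties using (T-∧; T-≡)
open import Data.Product using (_×_; _,_; proj₁; proj₂)
open import Data.Vec using (Vec; []; _∷_; lookup; map)
open import Data.Vec.Properties using (lookup-map)
open import Function.Bundles using (Equivalence)
open import Relation.Binary.PropositionalEquality using (_≡_; refl; sym; trans; cong₂)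

data Schema (n : ℕ) : Set where
  ‹_› : Fin n → Schema n
  ⊥ₛ  : Schema n
  _⇛_ : Schema n → Schema n → Schema n

infixr 5 _⇛_

x₀ : ∀ {n} → Schema (suc n)
x₀ = ‹ zero ›

x₁ : ∀ {n} → Schema (suc (suc n))
x₁ = ‹ suc zero ›

x₂ : ∀ {n} → Schema (suc (suc (suc n)))
x₂ = ‹ suc (suc zero) ›

x₃ : ∀ {n} → Schema (suc (suc (suc (suc n))))
x₃ = ‹ suc (suc (suc zero)) ›

¬ₛ : ∀ {n} → Schema n → Schema n
¬ₛ S = S ⇛ ⊥ₛ

instantiate : ∀ {n} → Vec Fm n → Schema n → Fm
instantiate σ ‹ i ›   = lookup σ i
instantiate σ ⊥ₛ      = ⊥'
instantiate σ (S ⇛ R) = instantiate σ S ⇒ instantiate σ R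

⟦_⟧ : ∀ {n} → Schema n → Vec Bool n → Bool
⟦ ‹ i › ⟧   ρ = lookup ρ i
⟦ ⊥ₛ ⟧      ρ = false
⟦ S ⇛ R ⟧   ρ = not (⟦ S ⟧ ρ) ∨ ⟦ R ⟧ ρ

eval-instantiate : ∀ {n} (v : Atom → Bool) (σ : Vec Fm n) (S : Schema n) →
                   eval v (instantiate σ S) ≡ ⟦ S ⟧ (map (eval v) σ)
eval-instantiate v σ ‹ i ›   = sym (lookup-map i (eval v) σ)
eval-instantiate v σ ⊥ₛ      = refl
eval-instantiate v σ (S ⇛ R) =
  cong₂ (λ a b → not a ∨ b) (eval-instantiate v σ S) (eval-instantiate v σ R)

every : ∀ n → (Vec Bool n → Bool) → Bool
every zero    f = f []
every (suc n) f = every n (λ ρ → f (true ∷ ρ)) ∧ every n (λ ρ → f (false ∷ ρ))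

every-sound : ∀ {n} (f : Vec Bool n → Bool) → T (every n f) → ∀ ρ → T (f ρ)
every-sound f h []          = h
every-sound f h (true ∷ ρ)  =
  every-sound (λ ρ → f (true ∷ ρ)) (proj₁ (Equivalence.to T-∧ h)) ρ
every-sound f h (false ∷ ρ) =
  every-sound (λ ρ → f (false ∷ ρ)) (proj₂ (Equivalence.to T-∧ h)) ρ

-- For a concrete schema, Valid S reduces to ⊤ by evaluating all 2ⁿ rows of
-- its truth table, so the validity argument of tautology can be left as _.
Valid : ∀ {n} → Schema n → Set
Valid {n} S = T (every n ⟦ S ⟧)

tautology : ∀ {n} (S : Schema n) → Valid S → (σ : Vec Fm n) → PF⊢ instantiate σ S
tautology S valid σ = taut λ v →
  trans (eval-instantiate v σ S)
        (Equivalence.to T-≡ (every-sound ⟦ S ⟧ valid (map (eval v) σ)))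

⇒-trans : ∀ {P Q R} → PF⊢ P ⇒ Q → PF⊢ Q ⇒ R → PF⊢ P ⇒ R
⇒-trans {P} {Q} {R} h k =
  mp (mp (tautology ((x₀ ⇛ x₁) ⇛ (x₁ ⇛ x₂) ⇛ (x₀ ⇛ x₂)) _ (P ∷ Q ∷ R ∷ [])) h) k

⇒-cases : ∀ {P R} → PF⊢ P ⇒ R → PF⊢ ¬' P ⇒ R → PF⊢ R
⇒-cases {P} {R} h k =
  mp (mp (tautology ((x₀ ⇛ x₁) ⇛ (¬ₛ x₀ ⇛ x₁) ⇛ x₁) _ (P ∷ R ∷ [])) h) k

∧-intro : ∀ {P Q} → PF⊢ P → PF⊢ Q → PF⊢ P ∧' Q
∧-intro {P} {Q} h k =
  mp (mp (tautology (x₀ ⇛ x₁ ⇛ ¬ₛ (x₀ ⇛ ¬ₛ x₁)) _ (P ∷ Q ∷ [])) h) k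

contraposition : ∀ {P Q} → PF⊢ P ⇒ Q → PF⊢ ¬' Q ⇒ ¬' P
contraposition {P} {Q} =
  mp (tautology ((x₀ ⇛ x₁) ⇛ (¬ₛ x₁ ⇛ ¬ₛ x₀)) _ (P ∷ Q ∷ []))

□p-mono : ∀ {P Q} → PF⊢ P ⇒ Q → PF⊢ □p P ⇒ □p Q
□p-mono {P} {Q} h = mp (Kp P Q) (necp h)

□f-mono : ∀ {P Q} → PF⊢ P ⇒ Q → PF⊢ □f P ⇒ □f Q
□f-mono {P} {Q} h = mp (Kf P Q) (necf h)

¬□p⇒◇p¬ : ∀ A → PF⊢ ¬' (□p A) ⇒ ◇p (¬' A)
¬□p⇒◇p¬ A = contraposition (□p-mono (tautology (¬ₛ (¬ₛ x₀) ⇛ x₀) _ (A ∷ [])))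

◇p¬⇒¬□p : ∀ A → PF⊢ ◇p (¬' A) ⇒ ¬' (□p A)
◇p¬⇒¬□p A = contraposition (□p-mono (tautology (x₀ ⇛ ¬ₛ (¬ₛ x₀)) _ (A ∷ [])))

□f-Settled : Fm → Set
□f-Settled B = (PF⊢ B ⇒ □f B) × (PF⊢ ¬' B ⇒ □f (¬' B))

□p-□f-settled : ∀ A → □f-Settled (□p A)
□p-□f-settled A =
  pf□ A , ⇒-trans (¬□p⇒◇p¬ A) (⇒-trans (pf◇ (¬' A)) (□f-mono (◇p¬⇒¬□p A)))

settled-⇒□f⇔□f⇒ : ∀ {B} C → □f-Settled B → PF⊢ (B ⇒ □f C) ⇔ □f (B ⇒ C)
settled-⇒□f⇔□f⇒ {B} C (B⇒□fB , ¬B⇒□f¬B) = ∧-intro forward backward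
  where
    H G : Fm
    H = B ⇒ □f C
    G = □f (B ⇒ C)

    when-B : PF⊢ B ⇒ (H ⇒ G)
    when-B = mp (tautology ((x₁ ⇛ x₂) ⇛ x₀ ⇛ (x₀ ⇛ x₁) ⇛ x₂) _ (B ∷ □f C ∷ G ∷ []))
                (□f-mono (tautology (x₁ ⇛ x₀ ⇛ x₁) _ (B ∷ C ∷ [])))

    when-¬B : PF⊢ ¬' B ⇒ (H ⇒ G)
    when-¬B = mp (tautology ((x₀ ⇛ x₂) ⇛ x₀ ⇛ x₁ ⇛ x₂) _ (¬' B ∷ H ∷ G ∷ []))
                 (⇒-trans ¬B⇒□f¬B (□f-mono (tautology (¬ₛ x₀ ⇛ x₀ ⇛ x₁) _ (B ∷ C ∷ []))))

    forward : PF⊢ H ⇒ G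
    forward = ⇒-cases when-B when-¬B

    backward : PF⊢ G ⇒ H
    backward =
      mp (mp (tautology ((x₀ ⇛ x₁ ⇛ x₂) ⇛ (x₃ ⇛ x₁) ⇛ (x₀ ⇛ x₃ ⇛ x₂)) _
                        (G ∷ □f B ∷ □f C ∷ B ∷ []))
             (Kf B C))
         B⇒□fB

proposition6p4 : ∀ (A : Fm) →
    PF⊢ ((□p A ⇒ □f A) ⇔ □f (□p A ⇒ A))
proposition6p4 A = settled-⇒□f⇔□f⇒ A (□p-□f-settled A)
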